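{- Let $\mathcal{J}$ be the subspace of $\mathbf{WMat}$ spanned by all elements $w-w_\sigma$, where $w=x_{i_1}\cdots x_{i_s}$ is a packed word, $\sigma\in\mathfrak{S}_s$, and $w_\sigma=x_{i_{\sigma(1)}}\cdots x_{i_{\sigma(s)}}$. Then $\mathcal{J}$ is a bi-ideal (a two-sided ideal and a coideal) of the Hopf algebra $\mathbf{WMat}$; equivalently, $\mathcal{J}$ is the kernel of the linear surjection $\Pi:\mathbf{WMat}\to\mathcal{C}_e$, $w\mapsto(|w|_{x_0},|w|_{x_1},\dots,|w|_{x_{\sup(w)}})$.
   Context: $\mathbb{K}$ is a field of characteristic $0$. Alphabet $X=\{x_0<x_1<\cdots\}$; $|w|_{x_i}$ is the number of occurrences of $x_i$ in the word $w$; $\sup(w)$ is the largest index occurring in $w$; $T_s(w)$ adds $s$ to every nonzero index and keeps $x_0$; $\mathrm{pack}(w)$ replaces the $m$-th smallest nonzero index occurring in $w$ by $m$ and keeps $x_0$. $\mathbf{WMat}$ has basis the packed words (words equal to their pack), product $u\ast v=u\,T_{\sup(u)}(v)$, and coproduct $\Delta(w)=\sum_{I\sqcup J=\{1,\dots,|w|\}}\mathrm{pack}(w[I])\otimes\mathrm{pack}(w[J]/w[I])$, where $w[I]$ is the subword at the positions of $I$ and $w[J]/w[I]$ is $w[J]$ with every letter occurring in $w[I]$ replaced by $x_0$. $\mathcal{C}_e$ is the vector space with basis the extended compositions $(\alpha_0,\alpha_1,\dots,\alpha_k)$, $k\ge0$, $\alpha_0\in\mathbb{N}$, $\alpha_1,\dots,\alpha_k\in\mathbb{N}^*$.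 -}

module Defs where

open import Level using (Level; _⊔_)
open import Algebra.Bundles using (CommutativeRing)
open import Data.Nat as ℕ using (ℕ; zero; suc; _≡ᵇ_)
open import Data.Bool.ListAction using (any)
open import Data.Bool using (Bool; true; false; if_then_else_; not)
open import Data.List using (List; []; _∷_; _++_; map; concatMap; filter; length; foldr; upTo; tabulate; lookup)
open import Data.List.Properties using (≡-dec)
open import Data.List.Relation.Unary.All using (All)
open import Data.Fin.Permutation using (Permutation′; _⟨$⟩ʳ_)
open import Data.Product using (Σ; ∃; _×_; _,_)
open import Relation.Nullary using (¬_; Dec; yes; no)
open import Relation.Binary.PropositionalEquality using (_≡_; _≢_)
open import Relation.Binary.Definitions using (DecidableEquality)

natK : ∀ {c ℓ} (R : CommutativeRing c ℓ) → ℕ → CommutativeRing.Carrier R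
natK R zero = CommutativeRing.0# R
natK R (suc n) = CommutativeRing._+_ R (CommutativeRing.1# R) (natK R n)

record CharZeroField (c ℓ : Level) : Set (Level.suc (c ⊔ ℓ)) where
  field
    cring : CommutativeRing c ℓ
  open CommutativeRing cring public
  field
    0≉1      : ¬ (0# ≈ 1#)
    inverse  : ∀ x → ¬ (x ≈ 0#) → Σ Carrier λ y → x * y ≈ 1#
    charZero : ∀ n → ¬ (natK cring (suc n) ≈ 0#)

-- Words over X = {x₀ < x₁ < …}: the letter x_i is encoded by i : ℕ.

Word : Set
Word = List ℕ

elemB : ℕ → Word → Bool
elemB k w = any (λ j → j ≡ᵇ k) w

count : ℕ → Word → ℕ
count i w = length (filter (λ j → j ℕ.≟ i) w)

-- sup(w): largest index occurring (0 for words without nonzero letters)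
sup : Word → ℕ
sup w = foldr ℕ._⊔_ 0 w

T : ℕ → Word → Word
T s = map (λ i → if i ≡ᵇ 0 then 0 else i ℕ.+ s)

-- pack(w): the m-th smallest nonzero index occurring in w becomes m.
-- The rank of i ≠ 0 is the number of k ∈ {1,…,i} occurring in w; x₀ ↦ x₀.
rank : Word → ℕ → ℕ
rank w i = if i ≡ᵇ 0 then 0
           else length (filter (λ k → Data.Bool._≟_ (elemB k w) true) (map suc (upTo i)))

pack : Word → Word
pack w = map (rank w) w

IsPacked : Word → Set
IsPacked w = pack w ≡ w

permute : (w : Word) → Permutation′ (length w) → Word
permute w σ = tabulate (λ i → lookup w (σ ⟨$⟩ʳ i))

mulW : Word → Word → Word
mulW u v = u ++ T (sup u) v

-- subsets of {1,…,n} as characteristic Bool-lists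
subsets : ℕ → List (List Bool)
subsets zero = [] ∷ []
subsets (suc n) = concatMap (λ s → (true ∷ s) ∷ (false ∷ s) ∷ []) (subsets n)

select : List Bool → Word → Word
select [] _ = []
select (_ ∷ _) [] = []
select (true ∷ bs) (x ∷ w) = x ∷ select bs w
select (false ∷ bs) (x ∷ w) = select bs w

-- w[J] / w[I] where J is the complement of I
quotW : List Bool → Word → Word
quotW I w = map (λ j → if elemB j (select I w) then 0 else j) (select (map not I) w)

Πw : Word → List ℕ
Πw w = map (λ i → count i w) (upTo (suc (sup w)))

IsExtComp : List ℕ → Set
IsExtComp [] = Data.Empty.⊥
  where import Data.Empty
IsExtComp (_ ∷ rest) = All (λ a → a ≢ 0) rest

module Over {c ℓ : Level} (F : CharZeroField c ℓ) where
  open CharZeroField F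

  Lin : Set → Set c
  Lin B = List (Carrier × B)

  coeff : {B : Set} → DecidableEquality B → Lin B → B → Carrier
  coeff _≟_ [] b = 0#
  coeff _≟_ ((a , b′) ∷ xs) b with b′ ≟ b
  ... | yes _ = a + coeff _≟_ xs b
  ... | no  _ = coeff _≟_ xs b

  -- elements of WMat / WMat ⊗ WMat and their equality (coefficientwise)
  WMatE : Set c
  WMatE = Lin Word

  InWMat : WMatE → Set c
  InWMat x = All (λ p → IsPacked (Data.Product.proj₂ p)) x

  _≟w_ : DecidableEquality Word
  _≟w_ = ≡-dec ℕ._≟_

  _≟ww_ : DecidableEquality (Word × Word)
  _≟ww_ = Data.Product.Properties.≡-dec _≟w_ _≟w_
    where import Data.Product.Properties

  _≈W_ : WMatE → WMatE → Set ℓ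
  x ≈W y = ∀ w → coeff _≟w_ x w ≈ coeff _≟w_ y w

  Tens : Set c
  Tens = Lin (Word × Word)

  _≈T_ : Tens → Tens → Set ℓ
  x ≈T y = ∀ p → coeff _≟ww_ x p ≈ coeff _≟ww_ y p

  scale : {B : Set} → Carrier → Lin B → Lin B
  scale a = map (λ p → a * Data.Product.proj₁ p , Data.Product.proj₂ p)

  mulL : WMatE → WMatE → WMatE
  mulL x y = concatMap (λ p → map (λ q → Data.Product.proj₁ p * Data.Product.proj₁ q
                                        , mulW (Data.Product.proj₂ p) (Data.Product.proj₂ q)) y) x

  Δw : Word → Tens
  Δw w = map (λ I → 1# , pack (select I w) , pack (quotW I w)) (subsets (length w))

  ΔL : WMatE → Tens
  ΔL x = concatMap (λ p → scale (Data.Product.proj₁ p) (Δw (Data.Product.proj₂ p))) x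

  εL : WMatE → Carrier
  εL x = coeff _≟w_ x []

  ΠL : WMatE → Lin (List ℕ)
  ΠL x = map (λ p → Data.Product.proj₁ p , Πw (Data.Product.proj₂ p)) x

  InKerΠ : WMatE → Set ℓ
  InKerΠ x = ∀ α → coeff (≡-dec ℕ._≟_) (ΠL x) α ≈ 0#

  record Gen : Set where
    constructor gen
    field
      word   : Word
      packed : IsPacked word
      perm   : Permutation′ (length word)

  genVec : Gen → WMatE
  genVec (gen w _ σ) = (1# , w) ∷ (- 1# , permute w σ) ∷ []

  genSum : List (Carrier × Gen) → WMatE
  genSum gs = concatMap (λ p → scale (Data.Product.proj₁ p) (genVec (Data.Product.proj₂ p))) gs

  In𝒥 : WMatE → Set (c ⊔ ℓ)
  In𝒥 x = Σ (List (Carrier × Gen)) λ gs → x ≈W genSum gs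

  data TGen : Set where
    left  : Gen → (v : Word) → IsPacked v → TGen
    right : (u : Word) → IsPacked u → Gen → TGen

  tgenVec : TGen → Tens
  tgenVec (left g v _)  = map (λ p → Data.Product.proj₁ p , (Data.Product.proj₂ p , v)) (genVec g)
  tgenVec (right u _ g) = map (λ p → Data.Product.proj₁ p , (u , Data.Product.proj₂ p)) (genVec g)

  In𝒥⊗+⊗𝒥 : Tens → Set (c ⊔ ℓ)
  In𝒥⊗+⊗𝒥 t = Σ (List (Carrier × TGen)) λ gs →
    t ≈T concatMap (λ p → scale (Data.Product.proj₁ p) (tgenVec (Data.Product.proj₂ p))) gs

  IsTwoSidedIdeal𝒥 : Set (c ⊔ ℓ)
  IsTwoSidedIdeal𝒥 = ∀ x y → InWMat y → In𝒥 x → In𝒥 (mulL x y) × In𝒥 (mulL y x)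

  IsCoideal𝒥 : Set (c ⊔ ℓ)
  IsCoideal𝒥 = ∀ x → In𝒥 x → In𝒥⊗+⊗𝒥 (ΔL x) × (εL x ≈ 0#)

-- Π is a complete invariant of packed words up to rearrangement: Π u ≡ Π v iff u is a permutation
-- of v, and every extended composition α is Π (canon α) for the sorted packed word canon α.
-- Hence a kernel element Σ a_w w of Π equals Σ a_w (w − canon (Π w)) ∈ 𝒥, while 𝒥 ⊆ ker Π because
-- Π is invariant under permutations. Multiplying by a packed word on either side maps permutations
-- to permutations (sup is permutation invariant), so 𝒥 is an ideal. For the coproduct, the value of
-- (Π ⊗ Π)(Δ w) does not change when the letters of w are permuted: permuting w only rearranges the
-- letters inside each pair (w[I], w[J]/w[I]), and pack and Π respect rearrangements. So Δ(𝒥) lies in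
-- the kernel of Π ⊗ Π, which on packed tensors is 𝒥 ⊗ WMat + WMat ⊗ 𝒥 by the same canonical-word
-- argument. The counit vanishes on 𝒥 since w and w_σ are empty together.

module Submission where

open import Defs
open import Level using (Level)
open import Data.Product using (Σ; _×_; _,_)
open import Function.Bundles using (_⇔_; mk⇔)
open import Relation.Binary.PropositionalEquality using (_≡_)

module Permutations {A : Set} where

  open import Data.Nat using (zero; suc; pred)
  open import Data.Fin using (Fin; zero; suc; punchIn; cast)
  open import Data.Fin.Permutation using (Permutation′; _⟨$⟩ʳ_; remove; punchIn-permute; _∘ₚ_; cast-id)
  open import Data.List using (List; []; _∷_; tabulate; lookup; length)
  open import Data.List.Properties using (tabulate-cong; tabulate-lookup)
  open import Data.List.Relation.Binary.Permutation.Propositional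
    using (_↭_; refl; prep; swap; trans; ↭-sym; ↭-reflexive; ↭⇒↭ₛ)
  open import Data.List.Relation.Binary.Permutation.Propositional.Properties using (↭-length)
  import Data.List.Relation.Binary.Permutation.Setoid as Setoid↭
  open import Data.List.Relation.Binary.Permutation.Setoid.Properties using (onIndices-lookup)
  open import Data.Product using (_,_)
  open import Relation.Binary.PropositionalEquality as ≡ using (cong; setoid)
  open import Function using (_∘_)

  tabulate-punchIn-↭ : ∀ {n} (f : Fin (suc n) → A) (j : Fin (suc n)) →
                       tabulate f ↭ f j ∷ tabulate (f ∘ punchIn j)
  tabulate-punchIn-↭ f zero = refl
  tabulate-punchIn-↭ {suc n} f (suc j) =
    trans (prep (f zero) (tabulate-punchIn-↭ (f ∘ suc) j)) (swap _ _ refl)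

  tabulate-permute-↭ : ∀ {n} (f : Fin n → A) (σ : Permutation′ n) →
                       tabulate (f ∘ (σ ⟨$⟩ʳ_)) ↭ tabulate f
  tabulate-permute-↭ {zero} f σ = refl
  tabulate-permute-↭ {suc n} f σ = trans (prep _ tail↭) (↭-sym (tabulate-punchIn-↭ f (σ ⟨$⟩ʳ zero)))
    where
    tail↭ : tabulate (λ i → f (σ ⟨$⟩ʳ suc i)) ↭ tabulate (f ∘ punchIn (σ ⟨$⟩ʳ zero))
    tail↭ = trans (↭-reflexive (tabulate-cong (λ i → cong f (punchIn-permute σ zero i))))
                  (tabulate-permute-↭ (f ∘ punchIn (σ ⟨$⟩ʳ zero)) (remove zero σ))

  permute-↭ : (w : List A) (σ : Permutation′ (length w)) → tabulate (lookup w ∘ (σ ⟨$⟩ʳ_)) ↭ w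
  permute-↭ w σ = trans (tabulate-permute-↭ (lookup w) σ) (↭-reflexive (tabulate-lookup w))

  tabulate-lookup-cast : ∀ (u : List A) {n} (e : n ≡ length u) → tabulate (lookup u ∘ cast e) ≡ u
  tabulate-lookup-cast [] {zero} e = ≡.refl
  tabulate-lookup-cast (x ∷ u) {suc n} e = cong (x ∷_) (tabulate-lookup-cast u (cong pred e))

  ↭⇒permute : ∀ {u w : List A} → u ↭ w →
              Σ (Permutation′ (length w)) λ σ → tabulate (lookup w ∘ (σ ⟨$⟩ʳ_)) ≡ u
  ↭⇒permute {u} {w} u↭w = cast-id e ∘ₚ Setoid↭.onIndices p , ≡.trans lookups (tabulate-lookup-cast u e)
    where
    p = ↭⇒↭ₛ u↭w
    e : length w ≡ length u
    e = ≡.sym (↭-length u↭w)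
    lookups : tabulate (lookup w ∘ ((cast-id e ∘ₚ Setoid↭.onIndices p) ⟨$⟩ʳ_)) ≡ tabulate (lookup u ∘ cast e)
    lookups = tabulate-cong λ i → ≡.sym (onIndices-lookup (setoid A) p (cast e i))

open Permutations

module Words where

  open import Data.Nat as ℕ using (ℕ; zero; suc; _+_; _∸_; _≤_; _<_; z≤n; s≤s; _≡ᵇ_)
  open import Data.Nat.Properties as ℕₚ
  open import Data.Bool using (true; false; if_then_else_)
  import Data.Bool as Bool
  open import Data.Bool.Properties using (∨-zeroʳ)
  open import Data.Unit using (tt)
  open import Data.Empty using (⊥-elim)
  open import Data.Sum using (_⊎_; inj₁; inj₂; [_,_]′)
  open import Data.Product using (_,_; proj₁; proj₂)
  open import Data.List using (List; []; _∷_; _++_; map; filter; length; upTo; applyUpTo; replicate)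
  open import Data.List.Properties
  open import Data.List.Relation.Binary.Permutation.Propositional
    using (_↭_; refl; prep; trans; ↭-sym; ↭-reflexive; ↭⇒↭ₛ)
  open import Data.List.Relation.Binary.Permutation.Propositional.Properties
    using (↭-length; filter-↭; ∈-resp-↭; map⁺; ++⁺; ++⁺ˡ; shift)
  open import Data.List.Relation.Binary.Permutation.Setoid.Properties using (foldr-commMonoid)
  open import Data.List.Membership.Propositional using (_∈_)
  open import Data.List.Membership.Propositional.Properties
  open import Data.List.Relation.Unary.Any as Any using (here; there)
  open import Data.List.Relation.Unary.All as All using (All; []; _∷_)
  import Data.List.Relation.Unary.All.Properties as Allₚ
  open import Relation.Nullary using (¬_; Dec; yes; no)
  open import Relation.Binary.PropositionalEquality as ≡ using (_≢_; cong; cong₂; sym; subst; setoid)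
  open import Function using (_∘_; id)

  elemB⇒∈ : ∀ {k w} → elemB k w ≡ true → k ∈ w
  elemB⇒∈ {k} {x ∷ w} e with x ≡ᵇ k in eq
  ... | true = here (sym (≡ᵇ⇒≡ x k (subst Bool.T (sym eq) tt)))
  ... | false = there (elemB⇒∈ e)

  ∈⇒elemB : ∀ {k w} → k ∈ w → elemB k w ≡ true
  ∈⇒elemB {k} {x ∷ w} (here ≡.refl) with k ≡ᵇ k | ≡⇒≡ᵇ k k ≡.refl
  ... | true | _ = ≡.refl
  ∈⇒elemB {k} {x ∷ w} (there p) rewrite ∈⇒elemB p = ∨-zeroʳ (x ≡ᵇ k)

  elemB-↭ : ∀ {k u v} → u ↭ v → elemB k u ≡ elemB k v
  elemB-↭ {k} {u} {v} p with elemB k u in eu | elemB k v in ev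
  ... | true  | true  = ≡.refl
  ... | false | false = ≡.refl
  ... | true  | false with () ← ≡.trans (sym ev) (∈⇒elemB (∈-resp-↭ p (elemB⇒∈ eu)))
  ... | false | true  with () ← ≡.trans (sym eu) (∈⇒elemB (∈-resp-↭ (↭-sym p) (elemB⇒∈ ev)))

  count-↭ : ∀ {i u v} → u ↭ v → count i u ≡ count i v
  count-↭ {i} p = ↭-length (filter-↭ (λ j → j ℕ.≟ i) p)

  sup-↭ : ∀ {u v} → u ↭ v → sup u ≡ sup v
  sup-↭ p = foldr-commMonoid (setoid ℕ) ⊔-0-isCommutativeMonoid (↭⇒↭ₛ p)

  Πw-↭ : ∀ {u v} → u ↭ v → Πw u ≡ Πw v
  Πw-↭ {u} {v} p = ≡.trans (map-cong (λ i → count-↭ {i} p) (upTo (suc (sup u))))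
                           (cong (λ n → map (λ i → count i v) (upTo (suc n))) (sup-↭ p))

  ∈⇒≤sup : ∀ {x w} → x ∈ w → x ≤ sup w
  ∈⇒≤sup {x} {y ∷ w} (here ≡.refl) = m≤m⊔n y (sup w)
  ∈⇒≤sup {x} {y ∷ w} (there p) = ≤-trans (∈⇒≤sup p) (m≤n⊔m y (sup w))

  sup≡0⊎sup∈ : ∀ w → sup w ≡ 0 ⊎ sup w ∈ w
  sup≡0⊎sup∈ [] = inj₁ ≡.refl
  sup≡0⊎sup∈ (x ∷ w) with ⊔-sel x (sup w)
  ... | inj₁ e = inj₂ (here e)
  ... | inj₂ e with sup≡0⊎sup∈ w
  ...   | inj₁ e0 = inj₁ (≡.trans e e0)
  ...   | inj₂ s∈w = inj₂ (there (subst (_∈ w) (sym e) s∈w))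

  sup-unique : ∀ w L → (∀ {x} → x ∈ w → x ≤ L) → L ≡ 0 ⊎ L ∈ w → sup w ≡ L
  sup-unique w L bounded attained = ≤-antisym
    ([ (λ e → subst (_≤ L) (sym e) z≤n) , bounded ]′ (sup≡0⊎sup∈ w))
    ([ (λ e → subst (_≤ sup w) (sym e) z≤n) , ∈⇒≤sup ]′ attained)

  count-∷-≡ : ∀ i w → count i (i ∷ w) ≡ suc (count i w)
  count-∷-≡ i w = cong length (filter-accept (λ j → j ℕ.≟ i) {i} {w} ≡.refl)

  count-∷-≢ : ∀ {i x} w → x ≢ i → count i (x ∷ w) ≡ count i w
  count-∷-≢ {i} w x≢i = cong length (filter-reject (λ j → j ℕ.≟ i) x≢i)

  count-++ : ∀ i xs ys → count i (xs ++ ys) ≡ count i xs + count i ys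
  count-++ i xs ys = ≡.trans (cong length (filter-++ (λ j → j ℕ.≟ i) xs ys))
                             (length-++ (filter (λ j → j ℕ.≟ i) xs))

  count-∉ : ∀ {i} w → (∀ {x} → x ∈ w → x ≢ i) → count i w ≡ 0
  count-∉ [] _ = ≡.refl
  count-∉ {i} (x ∷ w) h = ≡.trans (count-∷-≢ w (h (here ≡.refl))) (count-∉ w (h ∘ there))

  count>0⇒∈ : ∀ {i} w → 0 < count i w → i ∈ w
  count>0⇒∈ {i} (x ∷ w) pos with x ℕ.≟ i
  ... | yes x≡i = here (sym x≡i)
  ... | no x≢i = there (count>0⇒∈ w (subst (0 <_) (count-∷-≢ w x≢i) pos))

  ∈⇒count>0 : ∀ {i w} → i ∈ w → 0 < count i w
  ∈⇒count>0 i∈w = filter-some (λ j → j ℕ.≟ _) (Any.map sym i∈w)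

  sup<⇒count≡0 : ∀ {i} w → sup w < i → count i w ≡ 0
  sup<⇒count≡0 w sup<i = count-∉ w λ { x∈w ≡.refl → <-irrefl ≡.refl (≤-<-trans (∈⇒≤sup x∈w) sup<i) }

  count-replicate-≡ : ∀ a k → count k (replicate a k) ≡ a
  count-replicate-≡ zero k = ≡.refl
  count-replicate-≡ (suc a) k = ≡.trans (count-∷-≡ k (replicate a k)) (cong suc (count-replicate-≡ a k))

  count-replicate-≢ : ∀ {i} a k → k ≢ i → count i (replicate a k) ≡ 0
  count-replicate-≢ zero k _ = ≡.refl
  count-replicate-≢ (suc a) k k≢i = ≡.trans (count-∷-≢ (replicate a k) k≢i) (count-replicate-≢ a k k≢i)

  ∈-replicate⇒≡ : ∀ {x k : ℕ} a → x ∈ replicate a k → x ≡ k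
  ∈-replicate⇒≡ (suc a) (here e) = e
  ∈-replicate⇒≡ (suc a) (there p) = ∈-replicate⇒≡ a p

  DownClosed : Word → Set
  DownClosed w = ∀ {x k} → x ∈ w → suc k ≤ x → suc k ∈ w

  occurs? : (w : Word) (k : ℕ) → Dec (elemB k w ≡ true)
  occurs? w k = elemB k w Bool.≟ true

  occurrences : Word → ℕ → ℕ
  occurrences w n = length (filter (occurs? w) (map suc (upTo n)))

  length-map-suc-upTo : ∀ n → length (map suc (upTo n)) ≡ n
  length-map-suc-upTo n = ≡.trans (length-map suc (upTo n)) (length-applyUpTo id n)

  map≡⇒fixed : ∀ {f : ℕ → ℕ} {w x} → map f w ≡ w → x ∈ w → f x ≡ x
  map≡⇒fixed {w = y ∷ w} e (here ≡.refl) = ∷-injectiveˡ e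
  map≡⇒fixed {w = y ∷ w} e (there x∈w) = map≡⇒fixed (∷-injectiveʳ e) x∈w

  packed⇒downClosed : ∀ {w} → IsPacked w → DownClosed w
  packed⇒downClosed {w} packed {suc m} {k} x∈w (s≤s k<m) =
    elemB⇒∈ (All.lookup allOccur (∈-map⁺ suc (∈-upTo⁺ (s≤s k<m))))
    where
    allOccur : All (λ k → elemB k w ≡ true) (map suc (upTo (suc m)))
    allOccur = subst (All _)
      (filter-complete (occurs? w) (≡.trans (map≡⇒fixed packed x∈w) (sym (length-map-suc-upTo (suc m)))))
      (Allₚ.all-filter (occurs? w) _)

  downClosed⇒packed : ∀ {w} → DownClosed w → IsPacked w
  downClosed⇒packed {w} closed = map-id-local (All.tabulate fixed)
    where
    fixed : ∀ {x} → x ∈ w → rank w x ≡ x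
    fixed {zero} _ = ≡.refl
    fixed {suc m} x∈w = ≡.trans (cong length (filter-all (occurs? w) (All.tabulate occur)))
                                (length-map-suc-upTo (suc m))
      where
      occur : ∀ {y} → y ∈ map suc (upTo (suc m)) → elemB y w ≡ true
      occur y∈ with ∈-map⁻ suc y∈
      ... | j , j∈ , ≡.refl = ∈⇒elemB (closed x∈w (∈-upTo⁻ j∈))

  occurrences-suc : ∀ w m → occurrences w (suc m) ≡ occurrences w m + length (filter (occurs? w) (suc m ∷ []))
  occurrences-suc w m =
    ≡.trans (cong (length ∘ filter (occurs? w))
                  (≡.trans (cong (map suc) (sym (applyUpTo-∷ʳ id m))) (map-++ suc (upTo m) (m ∷ []))))
            (≡.trans (cong length (filter-++ (occurs? w) (map suc (upTo m)) (suc m ∷ [])))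
                     (length-++ (filter (occurs? w) (map suc (upTo m)))))

  occurrences-attained : ∀ w n k → suc k ≤ occurrences w n → Σ ℕ λ z → z ∈ w × occurrences w z ≡ suc k
  occurrences-attained w (suc m) k k<occ with occurs? w (suc m)
  ... | no ¬occ = occurrences-attained w m k (subst (suc k ≤_) same k<occ)
    where
    same : occurrences w (suc m) ≡ occurrences w m
    same = ≡.trans (occurrences-suc w m)
             (≡.trans (cong (λ t → occurrences w m + length t) (filter-reject (occurs? w) ¬occ)) (+-identityʳ _))
  ... | yes occ with suc k ℕ.≤? occurrences w m
  ...   | yes k<occ′ = occurrences-attained w m k k<occ′
  ...   | no k≮occ′ = suc m , elemB⇒∈ occ , ≡.trans one-more (cong suc (sym k≡occ))
    where
    one-more : occurrences w (suc m) ≡ suc (occurrences w m)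
    one-more = ≡.trans (occurrences-suc w m)
                 (≡.trans (cong (λ t → occurrences w m + length t) (filter-accept (occurs? w) occ))
                          (+-comm (occurrences w m) 1))
    k≡occ : k ≡ occurrences w m
    k≡occ = ≤-antisym (≤-pred (subst (suc k ≤_) one-more k<occ)) (≤-pred (≰⇒> k≮occ′))

  pack-isPacked : ∀ w → IsPacked (pack w)
  pack-isPacked w = downClosed⇒packed closed
    where
    closed : DownClosed (pack w)
    closed {y} {k} y∈ k<y with ∈-map⁻ (rank w) y∈
    ... | suc x , x∈w , ≡.refl with occurrences-attained w (suc x) k k<y
    ...   | suc z , z∈w , e = subst (_∈ pack w) e (∈-map⁺ (rank w) z∈w)

  mulW-downClosed : ∀ {u v} → DownClosed u → DownClosed v → DownClosed (mulW u v)
  mulW-downClosed {u} {v} closedᵘ closedᵛ {y} {k} y∈ k<y with ∈-++⁻ u y∈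
  ... | inj₁ y∈u = ∈-++⁺ˡ (closedᵘ y∈u k<y)
  ... | inj₂ y∈Tv with ∈-map⁻ (λ i → if i ≡ᵇ 0 then 0 else i + sup u) y∈Tv
  ...   | suc j , j∈v , ≡.refl with suc k ℕ.≤? sup u
  ...     | yes k<sup = ∈-++⁺ˡ (closedᵘ (sup∈ (sup≡0⊎sup∈ u)) k<sup)
    where
    sup∈ : sup u ≡ 0 ⊎ sup u ∈ u → sup u ∈ u
    sup∈ (inj₁ e) with () ← subst (suc k ≤_) e k<sup
    sup∈ (inj₂ s∈u) = s∈u
  ...     | no k≮sup = ∈-++⁺ʳ u (subst (_∈ T (sup u) v) (cong suc d+sup≡k)
                                       (∈-map⁺ (λ i → if i ≡ᵇ 0 then 0 else i + sup u) (closedᵛ j∈v (s≤s d≤j))))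
    where
    d = k ∸ sup u
    d+sup≡k : d + sup u ≡ k
    d+sup≡k = m∸n+n≡m (≤-pred (≰⇒> k≮sup))
    d≤j : d ≤ j
    d≤j = +-cancelʳ-≤ (sup u) d j (≤-pred (subst (λ t → suc t ≤ suc j + sup u) (sym d+sup≡k) k<y))

  mulW-isPacked : ∀ {u v} → IsPacked u → IsPacked v → IsPacked (mulW u v)
  mulW-isPacked pu pv = downClosed⇒packed (mulW-downClosed (packed⇒downClosed pu) (packed⇒downClosed pv))

  -- canon α = x₀^α₀ x₁^α₁ ⋯ x_k^α_k, the sorted packed word with Π-image α.
  blocks : ℕ → List ℕ → Word
  blocks k [] = []
  blocks k (a ∷ as) = replicate a k ++ blocks (suc k) as

  canon : List ℕ → Word
  canon [] = []
  canon (a ∷ as) = replicate a 0 ++ blocks 1 as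

  ∈-blocks⁻ : ∀ {x} k as → x ∈ blocks k as → k ≤ x × x < k + length as
  ∈-blocks⁻ {x} k (a ∷ as) x∈ with ∈-++⁻ (replicate a k) x∈
  ... | inj₁ p = subst (λ t → k ≤ t × t < k + length (a ∷ as)) (sym (∈-replicate⇒≡ a p))
                       (≤-refl , subst (k <_) (sym (+-suc k (length as))) (s≤s (m≤m+n k (length as))))
  ... | inj₂ p with ∈-blocks⁻ (suc k) as p
  ...   | k<x , x<end = <⇒≤ k<x , subst (x <_) (sym (+-suc k (length as))) x<end

  ∈-blocks⁺ : ∀ {x} k as → All (_≢ 0) as → k ≤ x → x < k + length as → x ∈ blocks k as
  ∈-blocks⁺ {x} k [] _ k≤x x<k = ⊥-elim (<-irrefl ≡.refl (<-≤-trans x<k (subst (_≤ x) (sym (+-identityʳ k)) k≤x)))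
  ∈-blocks⁺ {x} k (a ∷ as) (a≢0 ∷ as≢0) k≤x x<end with k ℕ.≟ x
  ... | yes ≡.refl = ∈-++⁺ˡ (here-replicate a a≢0)
    where
    here-replicate : ∀ a → a ≢ 0 → k ∈ replicate a k
    here-replicate zero a≢0 = ⊥-elim (a≢0 ≡.refl)
    here-replicate (suc a) _ = here ≡.refl
  ... | no k≢x = ∈-++⁺ʳ (replicate a k)
                   (∈-blocks⁺ (suc k) as as≢0 (≤∧≢⇒< k≤x k≢x) (subst (x <_) (+-suc k (length as)) x<end))

  canon-bounded : ∀ a as {x} → x ∈ canon (a ∷ as) → x ≤ length as
  canon-bounded a as x∈ with ∈-++⁻ (replicate a 0) x∈
  ... | inj₁ p = subst (_≤ length as) (sym (∈-replicate⇒≡ a p)) z≤n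
  ... | inj₂ p = ≤-pred (proj₂ (∈-blocks⁻ 1 as p))

  sup-canon : ∀ a as → All (_≢ 0) as → sup (canon (a ∷ as)) ≡ length as
  sup-canon a as as≢0 = sup-unique _ _ (canon-bounded a as) (attained as as≢0)
    where
    attained : ∀ as → All (_≢ 0) as → length as ≡ 0 ⊎ length as ∈ canon (a ∷ as)
    attained [] _ = inj₁ ≡.refl
    attained (b ∷ bs) bs≢0 = inj₂ (∈-++⁺ʳ (replicate a 0) (∈-blocks⁺ 1 (b ∷ bs) bs≢0 (s≤s z≤n) ≤-refl))

  canon-isPacked : ∀ α → IsExtComp α → IsPacked (canon α)
  canon-isPacked (a ∷ as) as≢0 = downClosed⇒packed λ x∈ k<x →
    ∈-++⁺ʳ (replicate a 0) (∈-blocks⁺ 1 as as≢0 (s≤s z≤n) (s≤s (≤-trans k<x (canon-bounded a as x∈))))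

  counts-blocks : ∀ k as (f : ℕ → ℕ) → All (_≢ 0) as → (∀ i → f i ≡ count (k + i) (blocks k as)) →
                  applyUpTo f (length as) ≡ as
  counts-blocks k [] f _ _ = ≡.refl
  counts-blocks k (a ∷ as) f (_ ∷ as≢0) f≡count =
    cong₂ _∷_ first (counts-blocks (suc k) as (f ∘ suc) as≢0 rest)
    where
    first : f 0 ≡ a
    first = begin
      f 0                                                    ≡⟨ f≡count 0 ⟩
      count (k + 0) (blocks k (a ∷ as))                      ≡⟨ cong (λ t → count t (blocks k (a ∷ as))) (+-identityʳ k) ⟩
      count k (replicate a k ++ blocks (suc k) as)           ≡⟨ count-++ k (replicate a k) _ ⟩
      count k (replicate a k) + count k (blocks (suc k) as)  ≡⟨ cong₂ _+_ (count-replicate-≡ a k) (count-∉ (blocks (suc k) as) later) ⟩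
      a + 0                                                  ≡⟨ +-identityʳ a ⟩
      a                                                      ∎
      where
      open ≡.≡-Reasoning
      later : ∀ {x} → x ∈ blocks (suc k) as → x ≢ k
      later x∈ ≡.refl = <-irrefl ≡.refl (proj₁ (∈-blocks⁻ (suc k) as x∈))
    rest : ∀ i → f (suc i) ≡ count (suc k + i) (blocks (suc k) as)
    rest i = ≡.trans (f≡count (suc i)) (≡.trans (cong (λ t → count t (blocks k (a ∷ as))) (+-suc k i))
               (≡.trans (count-++ (suc (k + i)) (replicate a k) (blocks (suc k) as))
                 (cong (_+ count (suc k + i) (blocks (suc k) as))
                   (count-replicate-≢ a k (λ k≡ → <-irrefl ≡.refl (subst (_≤ k + i) k≡ (m≤m+n k i)))))))

  Πw-canon : ∀ α → IsExtComp α → Πw (canon α) ≡ α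
  Πw-canon (a ∷ as) as≢0 =
    ≡.trans (cong (λ n → map (λ i → count i c) (upTo (suc n))) (sup-canon a as as≢0))
      (≡.trans (map-applyUpTo id (λ i → count i c) (suc (length as)))
        (cong₂ _∷_ zeros (counts-blocks 1 as (λ i → count (suc i) c) as≢0 nonzeros)))
    where
    c = canon (a ∷ as)
    zeros : count 0 c ≡ a
    zeros = ≡.trans (count-++ 0 (replicate a 0) (blocks 1 as))
              (≡.trans (cong₂ _+_ (count-replicate-≡ a 0)
                                  (count-∉ (blocks 1 as) λ { x∈ ≡.refl → case (proj₁ (∈-blocks⁻ 1 as x∈)) }))
                       (+-identityʳ a))
      where
      case : ¬ (1 ≤ 0)
      case ()
    nonzeros : ∀ i → count (suc i) c ≡ count (1 + i) (blocks 1 as)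
    nonzeros i = ≡.trans (count-++ (suc i) (replicate a 0) (blocks 1 as))
                         (cong (_+ count (suc i) (blocks 1 as)) (count-replicate-≢ a 0 (λ ())))

  packed⇒extComp : ∀ w → IsPacked w → IsExtComp (Πw w)
  packed⇒extComp w packed = Allₚ.map⁺ (All.tabulate nonzero)
    where
    nonzero : ∀ {y} → y ∈ applyUpTo suc (sup w) → count y w ≢ 0
    nonzero y∈ with ∈-applyUpTo⁻ suc y∈
    ... | i , i<sup , ≡.refl with sup≡0⊎sup∈ w
    ...   | inj₁ e with () ← subst (suc i ≤_) e i<sup
    ...   | inj₂ s∈w = λ e → <-irrefl (sym e) (∈⇒count>0 (packed⇒downClosed packed s∈w i<sup))

  applyUpTo-injective : ∀ (f g : ℕ → ℕ) n → applyUpTo f n ≡ applyUpTo g n → ∀ {i} → i < n → f i ≡ g i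
  applyUpTo-injective f g (suc n) e {zero} _ = ∷-injectiveˡ e
  applyUpTo-injective f g (suc n) e {suc i} (s≤s i<n) = applyUpTo-injective (f ∘ suc) (g ∘ suc) n (∷-injectiveʳ e) i<n

  length-Πw : ∀ w → length (Πw w) ≡ suc (sup w)
  length-Πw w = ≡.trans (length-map (λ i → count i w) (upTo (suc (sup w)))) (length-applyUpTo id (suc (sup w)))

  Πw≡⇒sup≡ : ∀ {u v} → Πw u ≡ Πw v → sup u ≡ sup v
  Πw≡⇒sup≡ {u} {v} e = suc-injective (≡.trans (sym (length-Πw u)) (≡.trans (cong length e) (length-Πw v)))

  Πw≡⇒count≡ : ∀ {u v} → Πw u ≡ Πw v → ∀ i → count i u ≡ count i v
  Πw≡⇒count≡ {u} {v} e i with i ℕ.<? suc (sup u)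
  ... | yes i≤sup = applyUpTo-injective (λ i → count i u) (λ i → count i v) (suc (sup u)) counts i≤sup
    where
    counts : applyUpTo (λ i → count i u) (suc (sup u)) ≡ applyUpTo (λ i → count i v) (suc (sup u))
    counts = ≡.trans (sym (map-applyUpTo id (λ i → count i u) (suc (sup u))))
               (≡.trans e (≡.trans (cong (λ n → map (λ i → count i v) (upTo (suc n))) (sym (Πw≡⇒sup≡ {u} {v} e)))
                                   (map-applyUpTo id (λ i → count i v) (suc (sup u)))))
  ... | no i≰sup = ≡.trans (sup<⇒count≡0 u sup<i) (sym (sup<⇒count≡0 v (subst (_< i) (Πw≡⇒sup≡ {u} {v} e) sup<i)))
    where
    sup<i : sup u < i
    sup<i = ≰⇒> (λ i≤sup → i≰sup (s≤s i≤sup))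

  count≡⇒↭ : ∀ u v → (∀ i → count i u ≡ count i v) → u ↭ v
  count≡⇒↭ [] [] _ = refl
  count≡⇒↭ [] (x ∷ v) counts with () ← ≡.trans (counts x) (count-∷-≡ x v)
  count≡⇒↭ (x ∷ u) v counts
    with v₁ , v₂ , ≡.refl ← ∈-∃++ (count>0⇒∈ v (subst (0 <_) (≡.trans (sym (count-∷-≡ x u)) (counts x)) (s≤s z≤n)))
    = trans (prep x (count≡⇒↭ u (v₁ ++ v₂) counts′)) (↭-sym (shift x v₁ v₂))
    where
    counts′ : ∀ i → count i u ≡ count i (v₁ ++ v₂)
    counts′ i with x ℕ.≟ i | counts i | count-↭ {i} (shift x v₁ v₂)
    ... | yes ≡.refl | cᵢ | s = suc-injective (≡.trans (sym (count-∷-≡ x u))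
                                   (≡.trans cᵢ (≡.trans s (count-∷-≡ x (v₁ ++ v₂)))))
    ... | no x≢i | cᵢ | s = ≡.trans (sym (count-∷-≢ u x≢i)) (≡.trans cᵢ (≡.trans s (count-∷-≢ (v₁ ++ v₂) x≢i)))

  Πw≡⇒↭ : ∀ {u v} → Πw u ≡ Πw v → u ↭ v
  Πw≡⇒↭ {u} {v} e = count≡⇒↭ u v (Πw≡⇒count≡ {u} {v} e)

  canon-↭ : ∀ {w} → IsPacked w → canon (Πw w) ↭ w
  canon-↭ {w} packed = Πw≡⇒↭ {canon (Πw w)} {w} (Πw-canon (Πw w) (packed⇒extComp w packed))

  canon-Πw-isPacked : ∀ {w} → IsPacked w → IsPacked (canon (Πw w))
  canon-Πw-isPacked {w} packed = canon-isPacked (Πw w) (packed⇒extComp w packed)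

  -- quotW I w ≡ quotient w[I] w[J] definitionally.
  quotient : Word → Word → Word
  quotient a b = map (λ j → if elemB j a then 0 else j) b

  rank-cong : ∀ {a a′} → (∀ k → elemB k a ≡ elemB k a′) → ∀ n → rank a n ≡ rank a′ n
  rank-cong same zero = ≡.refl
  rank-cong {a} {a′} same (suc n) = cong length
    (filter-≐ (occurs? a) (occurs? a′) ((λ e → ≡.trans (sym (same _)) e) , (λ e → ≡.trans (same _) e))
              (map suc (upTo (suc n))))

  pack-↭ : ∀ {a a′} → a ↭ a′ → pack a ↭ pack a′
  pack-↭ {a} {a′} p = trans (map⁺ (rank a) p) (↭-reflexive (map-cong (rank-cong {a} {a′} (λ k → elemB-↭ {k} p)) a′))

  quotient-↭ : ∀ {a a′ b b′} → a ↭ a′ → b ↭ b′ → quotient a b ↭ quotient a′ b′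
  quotient-↭ {a} {a′} {b} {b′} p q =
    trans (map⁺ _ q) (↭-reflexive (map-cong (λ j → cong (λ t → if t then 0 else j) (elemB-↭ {j} p)) b′))

  mulW-↭ˡ : ∀ {u w} v → u ↭ w → mulW u v ↭ mulW w v
  mulW-↭ˡ v p = ++⁺ p (↭-reflexive (cong (λ s → T s v) (sup-↭ p)))

  mulW-↭ʳ : ∀ v {u w} → u ↭ w → mulW v u ↭ mulW v w
  mulW-↭ʳ v p = ++⁺ˡ v (map⁺ _ p)

open Words

-- A formal sum z = Σ aᵢ bᵢ is handled through its values eval z H = Σ aᵢ H(bᵢ) on all functions H.
module FormalSums {c ℓ : Level} (F : CharZeroField c ℓ) where

  open CharZeroField F
  open Over F
  open import Algebra.Properties.Ring ring using (-‿distribʳ-*; -‿+-comm; -1*x≈-x; -0#≈0#; x∙y⁻¹≈ε⇒x≈y; x≈y⇒x∙y⁻¹≈ε)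
  open import Algebra.Properties.CommutativeSemigroup +-commutativeSemigroup using (interchange; x∙yz≈y∙xz)
  open import Relation.Binary.Reasoning.Setoid setoid
  open import Data.Nat using (suc; _≤_; z≤n; s≤s)
  open import Data.Nat.Properties using (≤-refl; ≤-trans; m≤n⇒m≤1+n)
  open import Data.Product using (_,_; proj₁; proj₂)
  open import Data.List using (List; []; _∷_; _++_; map; concatMap; length)
  open import Data.List.Relation.Unary.All using (All; []; _∷_)
  open import Relation.Nullary using (¬_; yes; no)
  open import Relation.Binary.PropositionalEquality as ≡ using ()
  open import Relation.Binary.Definitions using (DecidableEquality)
  open import Function using (_∘_)

  private variable B C D : Set

  eval : Lin B → (B → Carrier) → Carrier
  eval [] H = 0#
  eval ((a , b) ∷ z) H = a * H b + eval z H

  δ : DecidableEquality B → B → B → Carrier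
  δ _≟_ b b′ with b′ ≟ b
  ... | yes _ = 1#
  ... | no _ = 0#

  mapTerms : (B → C) → Lin B → Lin C
  mapTerms f = map (λ p → proj₁ p , f (proj₂ p))

  extend : (B → Lin C) → Lin B → Lin C
  extend g = concatMap (λ p → scale (proj₁ p) (g (proj₂ p)))

  bilinear : (B → C → D) → Lin B → Lin C → Lin D
  bilinear k x y = concatMap (λ p → map (λ q → proj₁ p * proj₁ q , k (proj₂ p) (proj₂ q)) y) x

  eval-cong : (z : Lin B) {H G : B → Carrier} → (∀ b → H b ≈ G b) → eval z H ≈ eval z G
  eval-cong [] _ = refl
  eval-cong ((a , b) ∷ z) H≈G = +-cong (*-congˡ (H≈G b)) (eval-cong z H≈G)

  eval-0 : (z : Lin B) → eval z (λ _ → 0#) ≈ 0#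
  eval-0 [] = refl
  eval-0 ((a , b) ∷ z) = trans (+-cong (zeroʳ a) (eval-0 z)) (+-identityʳ 0#)

  eval-++ : (x y : Lin B) (H : B → Carrier) → eval (x ++ y) H ≈ eval x H + eval y H
  eval-++ [] y H = sym (+-identityˡ _)
  eval-++ ((a , b) ∷ x) y H = trans (+-congˡ (eval-++ x y H)) (sym (+-assoc _ _ _))

  eval-scale : (k : Carrier) (x : Lin B) (H : B → Carrier) → eval (scale k x) H ≈ k * eval x H
  eval-scale k [] H = sym (zeroʳ k)
  eval-scale k ((a , b) ∷ x) H = trans (+-cong (*-assoc k a (H b)) (eval-scale k x H)) (sym (distribˡ k _ _))

  eval-+ : (x : Lin B) (H G : B → Carrier) → eval x (λ b → H b + G b) ≈ eval x H + eval x G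
  eval-+ [] H G = sym (+-identityʳ 0#)
  eval-+ ((a , b) ∷ x) H G = begin
    a * (H b + G b) + eval x (λ b → H b + G b)   ≈⟨ +-cong (distribˡ a (H b) (G b)) (eval-+ x H G) ⟩
    (a * H b + a * G b) + (eval x H + eval x G)  ≈⟨ interchange _ _ _ _ ⟩
    (a * H b + eval x H) + (a * G b + eval x G)  ∎

  eval-* : (x : Lin B) (k : Carrier) (H : B → Carrier) → eval x (λ b → k * H b) ≈ k * eval x H
  eval-* [] k H = sym (zeroʳ k)
  eval-* ((a , b) ∷ x) k H = begin
    a * (k * H b) + eval x (λ b → k * H b)  ≈⟨ +-cong (sym (*-assoc a k (H b))) (eval-* x k H) ⟩
    (a * k) * H b + k * eval x H            ≈⟨ +-congʳ (*-congʳ (*-comm a k)) ⟩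
    (k * a) * H b + k * eval x H            ≈⟨ +-congʳ (*-assoc k a (H b)) ⟩
    k * (a * H b) + k * eval x H            ≈⟨ distribˡ k _ _ ⟨
    k * (a * H b + eval x H)                ∎

  eval-neg : (x : Lin B) (H : B → Carrier) → eval x (λ b → - H b) ≈ - eval x H
  eval-neg [] H = sym -0#≈0#
  eval-neg ((a , b) ∷ x) H =
    trans (+-cong (sym (-‿distribʳ-* a (H b))) (eval-neg x H)) (-‿+-comm (a * H b) (eval x H))

  eval-- : (x : Lin B) (H G : B → Carrier) → eval x (λ b → H b - G b) ≈ eval x H - eval x G
  eval-- x H G = trans (eval-+ x H (λ b → - G b)) (+-congˡ (eval-neg x G))

  eval-mapTerms : (f : B → C) (x : Lin B) (H : C → Carrier) → eval (mapTerms f x) H ≈ eval x (H ∘ f)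
  eval-mapTerms f [] H = refl
  eval-mapTerms f ((a , b) ∷ x) H = +-congˡ (eval-mapTerms f x H)

  eval-extend : (g : B → Lin C) (z : Lin B) (H : C → Carrier) → eval (extend g z) H ≈ eval z (λ b → eval (g b) H)
  eval-extend g [] H = refl
  eval-extend g ((a , b) ∷ z) H =
    trans (eval-++ (scale a (g b)) (extend g z) H) (+-cong (eval-scale a (g b) H) (eval-extend g z H))

  eval-bilinear : (k : B → C → D) (x : Lin B) (y : Lin C) (H : D → Carrier) →
                  eval (bilinear k x y) H ≈ eval x (λ b → eval y (λ c → H (k b c)))
  eval-bilinear k [] y H = refl
  eval-bilinear k ((a , b) ∷ x) y H =
    trans (eval-++ row (bilinear k x y) H) (+-cong (eval-row y) (eval-bilinear k x y H))
    where
    row = map (λ q → a * proj₁ q , k b (proj₂ q)) y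
    eval-row : ∀ y → eval (map (λ q → a * proj₁ q , k b (proj₂ q)) y) H ≈ a * eval y (λ c → H (k b c))
    eval-row [] = sym (zeroʳ a)
    eval-row ((a′ , c′) ∷ y) = trans (+-cong (*-assoc a a′ _) (eval-row y)) (sym (distribˡ a _ _))

  eval-swap : (x : Lin B) (y : Lin C) (G : B → C → Carrier) →
              eval x (λ b → eval y (G b)) ≈ eval y (λ c → eval x (λ b → G b c))
  eval-swap [] y G = sym (eval-0 y)
  eval-swap ((a , b) ∷ x) y G = begin
    a * eval y (G b) + eval x (λ b → eval y (G b))                  ≈⟨ +-cong (sym (eval-* y a (G b))) (eval-swap x y G) ⟩
    eval y (λ c → a * G b c) + eval y (λ c → eval x (λ b → G b c))  ≈⟨ eval-+ y _ _ ⟨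
    eval y (λ c → a * G b c + eval x (λ b → G b c))                 ∎

  attach : {P : B → Set} (z : Lin B) → All (P ∘ proj₂) z → Lin (Σ B P)
  attach [] [] = []
  attach ((a , b) ∷ z) (pb ∷ pz) = (a , (b , pb)) ∷ attach z pz

  eval-attach : {P : B → Set} (z : Lin B) (pz : All (P ∘ proj₂) z) (H : B → Carrier) →
                eval (attach z pz) (H ∘ proj₁) ≈ eval z H
  eval-attach [] [] H = refl
  eval-attach ((a , b) ∷ z) (_ ∷ pz) H = +-congˡ (eval-attach z pz H)

  module _ (_≟_ : DecidableEquality B) where

    coeff-eval : (z : Lin B) (b : B) → coeff _≟_ z b ≈ eval z (δ _≟_ b)
    coeff-eval [] b = refl
    coeff-eval ((a , b′) ∷ z) b with b′ ≟ b
    ... | yes _ = +-cong (sym (*-identityʳ a)) (coeff-eval z b)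
    ... | no _ = trans (coeff-eval z b) (sym (trans (+-congʳ (zeroʳ a)) (+-identityˡ _)))

    coeff-∷-≢ : ∀ a {b w} z → ¬ (b ≡ w) → coeff _≟_ ((a , b) ∷ z) w ≈ coeff _≟_ z w
    coeff-∷-≢ a {b} {w} z b≢w with b ≟ w
    ... | yes b≡w with () ← b≢w b≡w
    ... | no _ = refl

    coeff-∷-≡ : ∀ a w z → coeff _≟_ ((a , w) ∷ z) w ≈ a + coeff _≟_ z w
    coeff-∷-≡ a w z with w ≟ w
    ... | yes _ = refl
    ... | no w≢w with () ← w≢w ≡.refl

    remove : B → Lin B → Lin B
    remove w [] = []
    remove w ((a , b) ∷ z) with b ≟ w
    ... | yes _ = remove w z
    ... | no _ = (a , b) ∷ remove w z

    length-remove : ∀ w z → length (remove w z) ≤ length z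
    length-remove w [] = z≤n
    length-remove w ((a , b) ∷ z) with b ≟ w
    ... | yes _ = m≤n⇒m≤1+n (length-remove w z)
    ... | no _ = s≤s (length-remove w z)

    length-remove-∷ : ∀ w a z → length (remove w ((a , w) ∷ z)) ≤ length z
    length-remove-∷ w a z with w ≟ w
    ... | yes _ = length-remove w z
    ... | no w≢w with () ← w≢w ≡.refl

    coeff-remove-≡ : ∀ w z → coeff _≟_ (remove w z) w ≈ 0#
    coeff-remove-≡ w [] = refl
    coeff-remove-≡ w ((a , b) ∷ z) with b ≟ w
    ... | yes _ = coeff-remove-≡ w z
    ... | no b≢w = trans (coeff-∷-≢ a (remove w z) b≢w) (coeff-remove-≡ w z)

    coeff-remove-≢ : ∀ w u z → ¬ (u ≡ w) → coeff _≟_ (remove w z) u ≈ coeff _≟_ z u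
    coeff-remove-≢ w u [] u≢w = refl
    coeff-remove-≢ w u ((a , b) ∷ z) u≢w with b ≟ w | b ≟ u
    ... | yes ≡.refl | yes ≡.refl with () ← u≢w ≡.refl
    ... | yes _ | no _ = coeff-remove-≢ w u z u≢w
    ... | no _ | yes ≡.refl = trans (coeff-∷-≡ a b (remove w z)) (+-congˡ (coeff-remove-≢ w b z u≢w))
    ... | no _ | no b≢u = trans (coeff-∷-≢ a (remove w z) b≢u) (coeff-remove-≢ w u z u≢w)

    eval-remove : ∀ z w (H : B → Carrier) → eval z H ≈ coeff _≟_ z w * H w + eval (remove w z) H
    eval-remove [] w H = sym (trans (+-congʳ (zeroˡ (H w))) (+-identityˡ 0#))
    eval-remove ((a , b) ∷ z) w H with b ≟ w
    ... | yes ≡.refl = begin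
      a * H b + eval z H                                     ≈⟨ +-congˡ (eval-remove z w H) ⟩
      a * H b + (coeff _≟_ z w * H w + eval (remove w z) H)  ≈⟨ +-assoc _ _ _ ⟨
      (a * H b + coeff _≟_ z w * H w) + eval (remove w z) H  ≈⟨ +-congʳ (distribʳ (H w) a _) ⟨
      (a + coeff _≟_ z w) * H w + eval (remove w z) H        ∎
    ... | no _ = trans (+-congˡ (eval-remove z w H)) (x∙yz≈y∙xz _ _ _)

    -- The terms at the head word contribute coeff · H(w) = 0; remove them all and recurse on the length.
    coeff≈0⇒eval≈0 : ∀ (z : Lin B) → (∀ b → coeff _≟_ z b ≈ 0#) → ∀ H → eval z H ≈ 0#
    coeff≈0⇒eval≈0 z = go (length z) z ≤-refl
      where
      go : ∀ n (z : Lin B) → length z ≤ n → (∀ b → coeff _≟_ z b ≈ 0#) → ∀ H → eval z H ≈ 0#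
      go n [] _ _ H = refl
      go (suc n) ((a , w) ∷ z) (s≤s len≤n) zero-coeffs H = begin
        eval ((a , w) ∷ z) H                                               ≈⟨ eval-remove ((a , w) ∷ z) w H ⟩
        coeff _≟_ ((a , w) ∷ z) w * H w + eval (remove w ((a , w) ∷ z)) H  ≈⟨ +-cong (trans (*-congʳ (zero-coeffs w)) (zeroˡ _)) rest ⟩
        0# + 0#                                                            ≈⟨ +-identityʳ 0# ⟩
        0#                                                                 ∎
        where
        rest-coeffs : ∀ u → coeff _≟_ (remove w ((a , w) ∷ z)) u ≈ 0#
        rest-coeffs u with u ≟ w
        ... | yes ≡.refl = coeff-remove-≡ w ((a , w) ∷ z)
        ... | no u≢w = trans (coeff-remove-≢ w u ((a , w) ∷ z) u≢w) (zero-coeffs u)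
        rest = go n (remove w ((a , w) ∷ z)) (≤-trans (length-remove-∷ w a z) len≤n) rest-coeffs H

    coeff≈⇒eval≈ : ∀ (x y : Lin B) → (∀ b → coeff _≟_ x b ≈ coeff _≟_ y b) → ∀ H → eval x H ≈ eval y H
    coeff≈⇒eval≈ x y same H = x∙y⁻¹≈ε⇒x≈y _ _ (begin
      eval x H - eval y H                 ≈⟨ +-congˡ (-1*x≈-x _) ⟨
      eval x H + - 1# * eval y H          ≈⟨ +-congˡ (eval-scale (- 1#) y H) ⟨
      eval x H + eval (scale (- 1#) y) H  ≈⟨ eval-++ x _ H ⟨
      eval (x ++ scale (- 1#) y) H        ≈⟨ coeff≈0⇒eval≈0 (x ++ scale (- 1#) y) difference H ⟩
      0#                                  ∎)
      where
      difference : ∀ b → coeff _≟_ (x ++ scale (- 1#) y) b ≈ 0#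
      difference b = begin
        coeff _≟_ (x ++ scale (- 1#) y) b                   ≈⟨ coeff-eval (x ++ scale (- 1#) y) b ⟩
        eval (x ++ scale (- 1#) y) (δ _≟_ b)                ≈⟨ eval-++ x _ _ ⟩
        eval x (δ _≟_ b) + eval (scale (- 1#) y) (δ _≟_ b)  ≈⟨ +-congˡ (trans (eval-scale (- 1#) y _) (-1*x≈-x _)) ⟩
        eval x (δ _≟_ b) - eval y (δ _≟_ b)                 ≈⟨ +-cong (coeff-eval x b) (-‿cong (coeff-eval y b)) ⟨
        coeff _≟_ x b - coeff _≟_ y b                       ≈⟨ x≈y⇒x∙y⁻¹≈ε (same b) ⟩
        0#                                                  ∎

    eval≈⇒coeff≈ : ∀ (x y : Lin B) → (∀ H → eval x H ≈ eval y H) → ∀ b → coeff _≟_ x b ≈ coeff _≟_ y b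
    eval≈⇒coeff≈ x y same b = trans (coeff-eval x b) (trans (same (δ _≟_ b)) (sym (coeff-eval y b)))

  InKernel : DecidableEquality C → (B → C) → Lin B → Set ℓ
  InKernel _≟_ f z = ∀ c → coeff _≟_ (mapTerms f z) c ≈ 0#

  InKernel⇒eval≈0 : (_≟_ : DecidableEquality C) (f : B → C) (z : Lin B) →
                    InKernel _≟_ f z → ∀ G → eval z (G ∘ f) ≈ 0#
  InKernel⇒eval≈0 _≟_ f z ker G = trans (sym (eval-mapTerms f z G)) (coeff≈0⇒eval≈0 _≟_ (mapTerms f z) ker G)

  eval≈0⇒InKernel : (_≟_ : DecidableEquality C) (f : B → C) (z : Lin B) →
                    (∀ G → eval z (G ∘ f) ≈ 0#) → InKernel _≟_ f z
  eval≈0⇒InKernel _≟_ f z killed c =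
    trans (coeff-eval _≟_ (mapTerms f z) c) (trans (eval-mapTerms f z _) (killed (δ _≟_ c)))

  eval-sub-InKernel : (_≟_ : DecidableEquality C) (f : B → C) (z : Lin B) → InKernel _≟_ f z →
                      ∀ H (g : C → B) → eval z (λ b → H b - H (g (f b))) ≈ eval z H
  eval-sub-InKernel _≟_ f z ker H g = begin
    eval z (λ b → H b - H (g (f b)))  ≈⟨ eval-- z H (H ∘ g ∘ f) ⟩
    eval z H - eval z (H ∘ g ∘ f)     ≈⟨ +-congˡ (-‿cong (InKernel⇒eval≈0 _≟_ f z ker (H ∘ g))) ⟩
    eval z H - 0#                     ≈⟨ +-congˡ -0#≈0# ⟩
    eval z H + 0#                     ≈⟨ +-identityʳ _ ⟩
    eval z H                          ∎


module BiIdeal {c ℓ : Level} (F : CharZeroField c ℓ) where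

  open CharZeroField F
  open Over F
  open FormalSums F
  open import Algebra.Properties.Ring ring using (-1*x≈-x; x≈y⇒x∙y⁻¹≈ε)
  open import Algebra.Properties.CommutativeSemigroup +-commutativeSemigroup using (interchange)
  open import Relation.Binary.Reasoning.Setoid setoid
  open import Data.Nat as ℕ using (ℕ)
  open import Data.Bool using (true; false; not)
  open import Data.Product using (_,_; proj₁; proj₂)
  import Data.Product.Properties as Productₚ
  open import Data.List using (List; []; _∷_; _++_; map; concatMap; length)
  import Data.List.Properties as Listₚ
  open import Data.List.Relation.Binary.Permutation.Propositional as ↭ using (_↭_; prep; swap)
  open import Data.List.Relation.Binary.Permutation.Propositional.Properties using (↭-length)
  open import Data.List.Relation.Unary.All as All using (All; []; _∷_)
  import Data.List.Relation.Unary.All.Properties as Allₚ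
  open import Relation.Binary.PropositionalEquality as ≡ using (cong)
  open import Relation.Binary.Definitions using (DecidableEquality)
  open import Function using (_∘_)

  permuted : Gen → Word
  permuted (gen w _ σ) = permute w σ

  permuted-↭ : ∀ g → permuted g ↭ Gen.word g
  permuted-↭ (gen w _ σ) = permute-↭ w σ

  genValue : (Word → Carrier) → Gen → Carrier
  genValue H g = H (Gen.word g) - H (permuted g)

  eval-genVec : ∀ g H → eval (genVec g) H ≈ genValue H g
  eval-genVec g H = trans (+-cong (*-identityˡ _) (+-identityʳ _)) (+-congˡ (-1*x≈-x _))

  eval-genSum : ∀ gs H → eval (genSum gs) H ≈ eval gs (genValue H)
  eval-genSum gs H = trans (eval-extend genVec gs H) (eval-cong gs (λ g → eval-genVec g H))

  permutationGen : ∀ {w} → IsPacked w → ∀ {u} → u ↭ w → Gen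
  permutationGen {w} packed u↭w = gen w packed (proj₁ (↭⇒permute u↭w))

  genValue-permutationGen : ∀ {w} (packed : IsPacked w) {u} (u↭w : u ↭ w) H →
                            genValue H (permutationGen packed u↭w) ≈ H w - H u
  genValue-permutationGen packed u↭w H = +-congˡ (-‿cong (reflexive (cong H (proj₂ (↭⇒permute u↭w)))))

  canonGen : ∀ {w} → IsPacked w → Gen
  canonGen packed = permutationGen packed (canon-↭ packed)

  genValue-canonGen : ∀ {w} (packed : IsPacked w) H → genValue H (canonGen packed) ≈ H w - H (canon (Πw w))
  genValue-canonGen packed = genValue-permutationGen packed (canon-↭ packed)

  In𝒥-intro : ∀ x gs → (∀ H → eval x H ≈ eval gs (genValue H)) → In𝒥 x
  In𝒥-intro x gs spans = gs , eval≈⇒coeff≈ _≟w_ x (genSum gs) (λ H → trans (spans H) (sym (eval-genSum gs H)))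

  In𝒥⇒eval : ∀ x (x∈𝒥 : In𝒥 x) H → eval x H ≈ eval (proj₁ x∈𝒥) (genValue H)
  In𝒥⇒eval x (gs , x≈) H = trans (coeff≈⇒eval≈ _≟w_ x (genSum gs) x≈ H) (eval-genSum gs H)

  In𝒥-resp : ∀ x y → (∀ H → eval x H ≈ eval y H) → In𝒥 y → In𝒥 x
  In𝒥-resp x y x≈y y∈𝒥 = In𝒥-intro x (proj₁ y∈𝒥) (λ H → trans (x≈y H) (In𝒥⇒eval y y∈𝒥 H))

  In𝒥-extend : {B : Set} (g : B → WMatE) (z : Lin B) → (∀ b → In𝒥 (g b)) → In𝒥 (extend g z)
  In𝒥-extend g [] _ = In𝒥-intro [] [] (λ _ → refl)
  In𝒥-extend g ((a , b) ∷ z) g∈𝒥 = In𝒥-intro (extend g ((a , b) ∷ z)) (scale a gs ++ gs′) λ H → begin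
    eval (scale a (g b) ++ extend g z) H                    ≈⟨ eval-++ (scale a (g b)) _ H ⟩
    eval (scale a (g b)) H + eval (extend g z) H            ≈⟨ +-cong (eval-scale a (g b) H) (In𝒥⇒eval (extend g z) rest H) ⟩
    a * eval (g b) H + eval gs′ (genValue H)                ≈⟨ +-congʳ (*-congˡ (In𝒥⇒eval (g b) (g∈𝒥 b) H)) ⟩
    a * eval gs (genValue H) + eval gs′ (genValue H)        ≈⟨ +-congʳ (eval-scale a gs (genValue H)) ⟨
    eval (scale a gs) (genValue H) + eval gs′ (genValue H)  ≈⟨ eval-++ (scale a gs) gs′ (genValue H) ⟨
    eval (scale a gs ++ gs′) (genValue H)                   ∎
    where
    rest = In𝒥-extend g z g∈𝒥
    gs = proj₁ (g∈𝒥 b)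
    gs′ = proj₁ rest

  PermutationInvariant : (Word → Carrier) → Set ℓ
  PermutationInvariant H = ∀ {u w} → u ↭ w → H u ≈ H w

  In𝒥⇒eval≈0 : ∀ x → In𝒥 x → ∀ {H} → PermutationInvariant H → eval x H ≈ 0#
  In𝒥⇒eval≈0 x x∈𝒥@(gs , _) {H} invariant = trans (In𝒥⇒eval x x∈𝒥 H)
    (trans (eval-cong gs (λ g → x≈y⇒x∙y⁻¹≈ε (sym (invariant (permuted-↭ g))))) (eval-0 gs))

  In𝒥-mapTerms : (f : Word → Word) → (∀ {w} → IsPacked w → IsPacked (f w)) → (∀ {u w} → u ↭ w → f u ↭ f w) →
                 ∀ x → In𝒥 x → In𝒥 (mapTerms f x)
  In𝒥-mapTerms f f-packed f-↭ x x∈𝒥@(gs , _) = In𝒥-intro (mapTerms f x) (mapTerms image gs) λ H → begin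
    eval (mapTerms f x) H                  ≈⟨ eval-mapTerms f x H ⟩
    eval x (H ∘ f)                         ≈⟨ In𝒥⇒eval x x∈𝒥 (H ∘ f) ⟩
    eval gs (genValue (H ∘ f))             ≈⟨ eval-cong gs (λ g → sym (genValue-image g H)) ⟩
    eval gs (genValue H ∘ image)           ≈⟨ eval-mapTerms image gs (genValue H) ⟨
    eval (mapTerms image gs) (genValue H)  ∎
    where
    image : Gen → Gen
    image g = permutationGen (f-packed (Gen.packed g)) (f-↭ (permuted-↭ g))
    genValue-image : ∀ g H → genValue H (image g) ≈ genValue (H ∘ f) g
    genValue-image g = genValue-permutationGen (f-packed (Gen.packed g)) (f-↭ (permuted-↭ g))

  In𝒥⇒InKerΠ : ∀ x → In𝒥 x → InKerΠ x
  In𝒥⇒InKerΠ x x∈𝒥 = eval≈0⇒InKernel (Listₚ.≡-dec ℕ._≟_) Πw x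
    (λ G → In𝒥⇒eval≈0 x x∈𝒥 (λ p → reflexive (cong G (Πw-↭ p))))

  -- x = Σ a_w (w − canon (Π w)) + Σ a_w canon (Π w), and the second sum is a function of Π x = 0.
  InKerΠ⇒In𝒥 : ∀ x → InWMat x → InKerΠ x → In𝒥 x
  InKerΠ⇒In𝒥 x packed ker = In𝒥-intro x (mapTerms (canonGen ∘ proj₂) (attach x packed)) λ H → begin
    eval x H                                                               ≈⟨ eval-sub-InKernel (Listₚ.≡-dec ℕ._≟_) Πw x ker H canon ⟨
    eval x (λ w → H w - H (canon (Πw w)))                                  ≈⟨ eval-attach x packed _ ⟨
    eval (attach x packed) (λ w → H (proj₁ w) - H (canon (Πw (proj₁ w))))  ≈⟨ eval-cong (attach x packed) (λ w → sym (genValue-canonGen (proj₂ w) H)) ⟩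
    eval (attach x packed) (genValue H ∘ canonGen ∘ proj₂)                 ≈⟨ eval-mapTerms (canonGen ∘ proj₂) (attach x packed) (genValue H) ⟨
    eval (mapTerms (canonGen ∘ proj₂) (attach x packed)) (genValue H)      ∎

  In𝒥-mulʳ : ∀ x y → InWMat y → In𝒥 x → In𝒥 (mulL x y)
  In𝒥-mulʳ x y y-packed x∈𝒥 = In𝒥-resp (mulL x y) (rightFactors (attach y y-packed))
    (λ H → begin
      eval (mulL x y) H                                                     ≈⟨ eval-bilinear mulW x y H ⟩
      eval x (λ w → eval y (λ v → H (mulW w v)))                            ≈⟨ eval-swap x y (λ w v → H (mulW w v)) ⟩
      eval y (λ v → eval x (λ w → H (mulW w v)))                            ≈⟨ eval-attach y y-packed _ ⟨
      eval (attach y y-packed) (λ v → eval x (λ w → H (mulW w (proj₁ v))))  ≈⟨ eval-cong (attach y y-packed) (λ v → sym (eval-mapTerms _ x H)) ⟩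
      eval (attach y y-packed) (λ v → eval (mapTerms (λ w → mulW w (proj₁ v)) x) H)
                                                                            ≈⟨ eval-extend _ (attach y y-packed) H ⟨
      eval (rightFactors (attach y y-packed)) H                             ∎)
    (In𝒥-extend _ (attach y y-packed) λ (v , pv) →
      In𝒥-mapTerms (λ w → mulW w v) (λ pw → mulW-isPacked pw pv) (mulW-↭ˡ v) x x∈𝒥)
    where
    rightFactors : Lin (Σ Word IsPacked) → WMatE
    rightFactors = extend (λ v → mapTerms (λ w → mulW w (proj₁ v)) x)

  In𝒥-mulˡ : ∀ x y → InWMat y → In𝒥 x → In𝒥 (mulL y x)
  In𝒥-mulˡ x y y-packed x∈𝒥 = In𝒥-resp (mulL y x) (leftFactors (attach y y-packed))
    (λ H → begin
      eval (mulL y x) H                                                      ≈⟨ eval-bilinear mulW y x H ⟩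
      eval y (λ v → eval x (λ w → H (mulW v w)))                             ≈⟨ eval-attach y y-packed _ ⟨
      eval (attach y y-packed) (λ v → eval x (H ∘ mulW (proj₁ v)))           ≈⟨ eval-cong (attach y y-packed) (λ v → sym (eval-mapTerms _ x H)) ⟩
      eval (attach y y-packed) (λ v → eval (mapTerms (mulW (proj₁ v)) x) H)  ≈⟨ eval-extend _ (attach y y-packed) H ⟨
      eval (leftFactors (attach y y-packed)) H                               ∎)
    (In𝒥-extend _ (attach y y-packed) λ (v , pv) →
      In𝒥-mapTerms (mulW v) (mulW-isPacked pv) (mulW-↭ʳ v) x x∈𝒥)
    where
    leftFactors : Lin (Σ Word IsPacked) → WMatE
    leftFactors = extend (λ v → mapTerms (mulW (proj₁ v)) x)

  isTwoSidedIdeal : IsTwoSidedIdeal𝒥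
  isTwoSidedIdeal x y y-packed x∈𝒥 = In𝒥-mulʳ x y y-packed x∈𝒥 , In𝒥-mulˡ x y y-packed x∈𝒥

  sumOver : {A : Set} → (A → Carrier) → List A → Carrier
  sumOver f [] = 0#
  sumOver f (a ∷ as) = f a + sumOver f as

  sumOver-cong : {A : Set} {f g : A → Carrier} (as : List A) → (∀ a → f a ≈ g a) → sumOver f as ≈ sumOver g as
  sumOver-cong [] _ = refl
  sumOver-cong (a ∷ as) f≈g = +-cong (f≈g a) (sumOver-cong as f≈g)

  sumOver-++ : {A : Set} (f : A → Carrier) (as bs : List A) → sumOver f (as ++ bs) ≈ sumOver f as + sumOver f bs
  sumOver-++ f [] bs = sym (+-identityˡ _)
  sumOver-++ f (a ∷ as) bs = trans (+-congˡ (sumOver-++ f as bs)) (sym (+-assoc _ _ _))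

  sumOver-concatMap : {A B : Set} (f : B → Carrier) (g : A → List B) (as : List A) →
                      sumOver f (concatMap g as) ≈ sumOver (sumOver f ∘ g) as
  sumOver-concatMap f g [] = refl
  sumOver-concatMap f g (a ∷ as) = trans (sumOver-++ f (g a) (concatMap g as)) (+-congˡ (sumOver-concatMap f g as))

  eval-units : {A B : Set} (f : A → B) (as : List A) (H : B → Carrier) →
               eval (map (λ a → 1# , f a) as) H ≈ sumOver (H ∘ f) as
  eval-units f [] H = refl
  eval-units f (a ∷ as) H = +-cong (*-identityˡ _) (eval-units f as H)

  sumOverSplits : Word → (Word × Word → Carrier) → Carrier
  sumOverSplits w φ = sumOver (λ I → φ (select I w , select (map not I) w)) (subsets (length w))

  placeLetter : ℕ → (Word × Word → Carrier) → Word × Word → Carrier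
  placeLetter x φ (a , b) = φ (x ∷ a , b) + (φ (a , x ∷ b) + 0#)

  sumOverSplits-∷ : ∀ x u φ → sumOverSplits (x ∷ u) φ ≈ sumOverSplits u (placeLetter x φ)
  sumOverSplits-∷ x u φ = sumOver-concatMap _ (λ I → (true ∷ I) ∷ (false ∷ I) ∷ []) (subsets (length u))

  Respects↭² : (Word × Word → Carrier) → Set ℓ
  Respects↭² φ = ∀ {a a′ b b′} → a ↭ a′ → b ↭ b′ → φ (a , b) ≈ φ (a′ , b′)

  placeLetter-resp : ∀ x φ → Respects↭² φ → Respects↭² (placeLetter x φ)
  placeLetter-resp x φ φ-resp p q = +-cong (φ-resp (prep x p) q) (+-congʳ (φ-resp p (prep x q)))

  placeLetter-comm : ∀ x y φ → Respects↭² φ → ∀ ab → placeLetter y (placeLetter x φ) ab ≈ placeLetter x (placeLetter y φ) ab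
  placeLetter-comm x y φ φ-resp (a , b) = begin
    placeLetter y (placeLetter x φ) (a , b)  ≈⟨ drop0s _ _ _ _ ⟩
    (φ (x ∷ y ∷ a , b) + φ (y ∷ a , x ∷ b)) + (φ (x ∷ a , y ∷ b) + φ (a , x ∷ y ∷ b))
                                             ≈⟨ interchange _ _ _ _ ⟩
    (φ (x ∷ y ∷ a , b) + φ (x ∷ a , y ∷ b)) + (φ (y ∷ a , x ∷ b) + φ (a , x ∷ y ∷ b))
                                             ≈⟨ +-cong (+-congʳ swap₁) (+-congˡ swap₂) ⟩
    (φ (y ∷ x ∷ a , b) + φ (x ∷ a , y ∷ b)) + (φ (y ∷ a , x ∷ b) + φ (a , y ∷ x ∷ b))
                                             ≈⟨ drop0s _ _ _ _ ⟨
    placeLetter x (placeLetter y φ) (a , b)  ∎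
    where
    swap₁ = φ-resp (swap x y ↭.refl) ↭.refl
    swap₂ = φ-resp ↭.refl (swap x y ↭.refl)
    drop0s : ∀ A B C D → (A + (B + 0#)) + ((C + (D + 0#)) + 0#) ≈ (A + B) + (C + D)
    drop0s A B C D = +-cong (+-congˡ (+-identityʳ B)) (trans (+-identityʳ _) (+-congˡ (+-identityʳ D)))

  sumOverSplits-↭ : ∀ {u u′} → u ↭ u′ → ∀ φ → Respects↭² φ → sumOverSplits u φ ≈ sumOverSplits u′ φ
  sumOverSplits-↭ ↭.refl φ φ-resp = refl
  sumOverSplits-↭ {x ∷ xs} {.x ∷ ys} (prep x p) φ φ-resp = begin
    sumOverSplits (x ∷ xs) φ            ≈⟨ sumOverSplits-∷ x xs φ ⟩
    sumOverSplits xs (placeLetter x φ)  ≈⟨ sumOverSplits-↭ p (placeLetter x φ) (placeLetter-resp x φ φ-resp) ⟩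
    sumOverSplits ys (placeLetter x φ)  ≈⟨ sumOverSplits-∷ x ys φ ⟨
    sumOverSplits (x ∷ ys) φ            ∎
  sumOverSplits-↭ {x ∷ y ∷ xs} {.y ∷ .x ∷ ys} (swap x y p) φ φ-resp = begin
    sumOverSplits (x ∷ y ∷ xs) φ                        ≈⟨ sumOverSplits-∷ x (y ∷ xs) φ ⟩
    sumOverSplits (y ∷ xs) (placeLetter x φ)            ≈⟨ sumOverSplits-∷ y xs (placeLetter x φ) ⟩
    sumOverSplits xs (placeLetter y (placeLetter x φ))  ≈⟨ sumOverSplits-↭ p _ (placeLetter-resp y _ (placeLetter-resp x φ φ-resp)) ⟩
    sumOverSplits ys (placeLetter y (placeLetter x φ))  ≈⟨ sumOver-cong (subsets (length ys)) (λ I → placeLetter-comm x y φ φ-resp _) ⟩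
    sumOverSplits ys (placeLetter x (placeLetter y φ))  ≈⟨ sumOverSplits-∷ x ys (placeLetter y φ) ⟨
    sumOverSplits (x ∷ ys) (placeLetter y φ)            ≈⟨ sumOverSplits-∷ y (x ∷ ys) φ ⟨
    sumOverSplits (y ∷ x ∷ ys) φ                        ∎
  sumOverSplits-↭ (↭.trans p q) φ φ-resp = trans (sumOverSplits-↭ p φ φ-resp) (sumOverSplits-↭ q φ φ-resp)

  Π⊗Π : Word × Word → List ℕ × List ℕ
  Π⊗Π (u , v) = Πw u , Πw v

  _≟Π⊗Π_ : DecidableEquality (List ℕ × List ℕ)
  _≟Π⊗Π_ = Productₚ.≡-dec (Listₚ.≡-dec ℕ._≟_) (Listₚ.≡-dec ℕ._≟_)

  Δw-invariant : ∀ G → PermutationInvariant (λ w → eval (Δw w) (G ∘ Π⊗Π))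
  Δw-invariant G {u} {w} u↭w = begin
    eval (Δw u) (G ∘ Π⊗Π)  ≈⟨ eval-units _ (subsets (length u)) _ ⟩
    sumOverSplits u φ      ≈⟨ sumOverSplits-↭ u↭w φ φ-resp ⟩
    sumOverSplits w φ      ≈⟨ eval-units _ (subsets (length w)) _ ⟨
    eval (Δw w) (G ∘ Π⊗Π)  ∎
    where
    φ : Word × Word → Carrier
    φ (a , b) = G (Πw (pack a) , Πw (pack (quotient a b)))
    φ-resp : Respects↭² φ
    φ-resp p q = reflexive (≡.cong₂ (λ s t → G (s , t)) (Πw-↭ (pack-↭ p)) (Πw-↭ (pack-↭ (quotient-↭ p q))))

  δ[]-invariant : PermutationInvariant (δ _≟w_ [])
  δ[]-invariant {[]} {[]} _ = refl
  δ[]-invariant {_ ∷ _} {_ ∷ _} _ = refl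
  δ[]-invariant {[]} {_ ∷ _} p with () ← ↭-length p
  δ[]-invariant {_ ∷ _} {[]} p with () ← ↭-length p

  PackedPair : Word × Word → Set
  PackedPair q = IsPacked (proj₁ q) × IsPacked (proj₂ q)

  ΔL-packed : ∀ x → All (PackedPair ∘ proj₂) (ΔL x)
  ΔL-packed [] = []
  ΔL-packed ((a , w) ∷ x) = Allₚ.++⁺ (Allₚ.map⁺ (Allₚ.map⁺
    (All.universal (λ I → pack-isPacked _ , pack-isPacked _) (subsets (length w))))) (ΔL-packed x)

  eval-tgenVec-left : ∀ g v pv H → eval (tgenVec (left g v pv)) H ≈ genValue (λ w → H (w , v)) g
  eval-tgenVec-left g v _ H = trans (eval-mapTerms (_, v) (genVec g) H) (eval-genVec g (λ w → H (w , v)))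

  eval-tgenVec-right : ∀ u pu g H → eval (tgenVec (right u pu g)) H ≈ genValue (λ w → H (u , w)) g
  eval-tgenVec-right u _ g H = trans (eval-mapTerms (u ,_) (genVec g) H) (eval-genVec g (λ w → H (u , w)))

  telescope : ∀ a b d → (a - b) + (b - d) ≈ a - d
  telescope a b d = begin
    (a - b) + (b - d)    ≈⟨ +-assoc a (- b) _ ⟩
    a + (- b + (b - d))  ≈⟨ +-congˡ (+-assoc (- b) b (- d)) ⟨
    a + ((- b + b) - d)  ≈⟨ +-congˡ (+-congʳ (-‿inverseˡ b)) ⟩
    a + (0# - d)         ≈⟨ +-congˡ (+-identityˡ (- d)) ⟩
    a - d                ∎

  -- u ⊗ v − ũ ⊗ ṽ = (u − ũ) ⊗ v + ũ ⊗ (v − ṽ) with ũ = canon (Π u), ṽ = canon (Π v),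
  -- and Σ a (ũ ⊗ ṽ) is a function of (Π ⊗ Π) t = 0.
  InKerΠ⊗Π⇒In𝒥⊗+⊗𝒥 : ∀ t → All (PackedPair ∘ proj₂) t → InKernel _≟Π⊗Π_ Π⊗Π t → In𝒥⊗+⊗𝒥 t
  InKerΠ⊗Π⇒In𝒥⊗+⊗𝒥 t packed ker = extend steps (attach t packed) ,
    eval≈⇒coeff≈ _≟ww_ t (extend tgenVec (extend steps (attach t packed))) λ H → begin
      eval t H                                                                  ≈⟨ eval-sub-InKernel _≟Π⊗Π_ Π⊗Π t ker H canon² ⟨
      eval t (λ q → H q - H (canon² (Π⊗Π q)))                                   ≈⟨ eval-attach t packed _ ⟨
      eval (attach t packed) (λ q → H (proj₁ q) - H (canon² (Π⊗Π (proj₁ q))))   ≈⟨ eval-cong (attach t packed) (λ q → sym (eval-steps q H)) ⟩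
      eval (attach t packed) (λ q → eval (steps q) (λ g → eval (tgenVec g) H))  ≈⟨ eval-extend steps (attach t packed) _ ⟨
      eval (extend steps (attach t packed)) (λ g → eval (tgenVec g) H)          ≈⟨ eval-extend tgenVec (extend steps (attach t packed)) H ⟨
      eval (extend tgenVec (extend steps (attach t packed))) H                  ∎
    where
    canon² : List ℕ × List ℕ → Word × Word
    canon² (α , β) = canon α , canon β
    steps : Σ (Word × Word) PackedPair → Lin TGen
    steps ((u , v) , (pu , pv)) = (1# , left (canonGen pu) v pv) ∷ (1# , right (canon (Πw u)) (canon-Πw-isPacked pu) (canonGen pv)) ∷ []
    eval-steps : ∀ q H → eval (steps q) (λ g → eval (tgenVec g) H) ≈ H (proj₁ q) - H (canon² (Π⊗Π (proj₁ q)))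
    eval-steps ((u , v) , (pu , pv)) H = begin
      1# * eval (tgenVec l) H + (1# * eval (tgenVec r) H + 0#)  ≈⟨ +-cong (*-identityˡ _) (trans (+-identityʳ _) (*-identityˡ _)) ⟩
      eval (tgenVec l) H + eval (tgenVec r) H                   ≈⟨ +-cong l-value r-value ⟩
      (H (u , v) - H (ũ , v)) + (H (ũ , v) - H (ũ , ṽ))         ≈⟨ telescope _ _ _ ⟩
      H (u , v) - H (ũ , ṽ)                                     ∎
      where
      ũ = canon (Πw u)
      ṽ = canon (Πw v)
      l = left (canonGen pu) v pv
      r = right ũ (canon-Πw-isPacked pu) (canonGen pv)
      l-value = trans (eval-tgenVec-left (canonGen pu) v pv H) (genValue-canonGen pu (λ w → H (w , v)))
      r-value = trans (eval-tgenVec-right ũ (canon-Πw-isPacked pu) (canonGen pv) H) (genValue-canonGen pv (λ w → H (ũ , w)))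

  isCoideal : IsCoideal𝒥
  isCoideal x x∈𝒥 = InKerΠ⊗Π⇒In𝒥⊗+⊗𝒥 (ΔL x) (ΔL-packed x) ker , counit
    where
    ker : InKernel _≟Π⊗Π_ Π⊗Π (ΔL x)
    ker = eval≈0⇒InKernel _≟Π⊗Π_ Π⊗Π (ΔL x) λ G →
      trans (eval-extend Δw x (G ∘ Π⊗Π)) (In𝒥⇒eval≈0 x x∈𝒥 (Δw-invariant G))
    counit : εL x ≈ 0#
    counit = trans (coeff-eval _≟w_ x []) (In𝒥⇒eval≈0 x x∈𝒥 δ[]-invariant)

mainTheorem10 : ∀ {c ℓ : Level} (F : CharZeroField c ℓ) → let open Over F in
    (IsTwoSidedIdeal𝒥 × IsCoideal𝒥)
    × ((∀ α → IsExtComp α → Σ Word λ w → IsPacked w × Πw w ≡ α)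
       × (∀ x → InWMat x → (In𝒥 x ⇔ InKerΠ x)))
mainTheorem10 F =
  (isTwoSidedIdeal , isCoideal) ,
  (λ α α-ext → canon α , canon-isPacked α α-ext , Πw-canon α α-ext) ,
  (λ x packed → mk⇔ (In𝒥⇒InKerΠ x) (InKerΠ⇒In𝒥 x packed))
  where open BiIdeal F
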